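{- Let $n\in\mathbb{N}$ and $t\ge 3$. Then $\tilde{R}(\dot C^{(rbr)}_{t},Q_n)\le (t-1)n$.
   Context: $Q_N$ denotes the Boolean lattice of all subsets of an $N$-element set ordered by inclusion. An (induced) copy of a poset $P$ in a poset $Q$ is a subset of $Q$ which, with the inherited order, is isomorphic to $P$. A colored poset $\dot P$ is a poset with a coloring of its elements in blue and red; a copy of $\dot P$ in a colored $Q$ is an induced copy of $P$ whose vertices have the same colors as the corresponding vertices of $\dot P$. $\dot Q_n^{(b)}$ (resp. $\dot Q_n^{(r)}$) is $Q_n$ colored entirely blue (resp. red). $\tilde{R}(\dot P,Q_n)$ is the minimum $N$ such that every blue/red coloring of $Q_N$ contains a copy of $\dot P$, of $\dot Q_n^{(b)}$, or of $\dot Q_n^{(r)}$. The red-alternating chain $\dot C_t^{(rbr)}$ is a chain on $t$ vertices colored alternately red and blue along the chain, with the minimal vertex red. -}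

module Defs where

open import Data.Nat using (ℕ; zero; suc; _≤_)
open import Data.Fin using (Fin; toℕ)
open import Data.Fin.Subset using (Subset; _⊆_)
open import Data.Product using (Σ; _×_)
open import Data.Sum using (_⊎_)
open import Function.Bundles using (_⇔_)
open import Relation.Binary.PropositionalEquality using (_≡_)

data Color : Set where
  blue red : Color

flipColor : Color → Color
flipColor blue = red
flipColor red  = blue

-- Q_N : the Boolean lattice of subsets of Fin N (Data.Fin.Subset), ordered by ⊆.
-- A blue/red colouring of Q_N.
Coloring : ℕ → Set
Coloring N = Subset N → Color

-- Colour of the k-th vertex (k = 0 is the minimum) of the red-alternating chain.
altColor : ℕ → Color
altColor zero    = red
altColor (suc k) = flipColor (altColor k)

HasAltChain : (t N : ℕ) → Coloring N → Set
HasAltChain t N c =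
  Σ (Fin t → Subset N) λ f →
    ((i j : Fin t) → (toℕ i ≤ toℕ j) ⇔ (f i ⊆ f j)) ×
    ((i : Fin t) → c (f i) ≡ altColor (toℕ i))

HasMonoCube : (col : Color) (n N : ℕ) → Coloring N → Set
HasMonoCube col n N c =
  Σ (Subset n → Subset N) λ f →
    ((A B : Subset n) → (A ⊆ B) ⇔ (f A ⊆ f B)) ×
    ((A : Subset n) → c (f A) ≡ col)

RamseyProp : (t n N : ℕ) → Set
RamseyProp t n N =
  (c : Coloring N) →
    HasAltChain t N c ⊎ HasMonoCube blue n N c ⊎ HasMonoCube red n N c

-- R̃(Ċ_t^(rbr), Q_n) ≤ M  :⇔  the minimum N with RamseyProp t n N is ≤ M,
-- i.e. some N ≤ M has the property.
RtildeAltChain≤ : (t n M : ℕ) → Set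
RtildeAltChain≤ t n M = Σ ℕ λ N → (N ≤ M) × RamseyProp t n N

-- Split the ground set of Q_N, N = (t-1)n, into t-1 blocks of n points. The first two blocks,
-- Q_n × Q_n, already contain a red < blue < red chain or a monochromatic Q_n: if some red
-- (A′, ⊥) lies below a red (A, ⊤), the fibre {A} × Q_n either has a blue vertex or is a red Q_n;
-- otherwise A ↦ (A, ⊤) if some (A′, ⊥) with A′ ⊆ A is red, and A ↦ (A, ⊥) if not, is a blue Q_n.
-- Each of the remaining t-3 blocks, placed above the chain built so far, either contains a
-- vertex of the next colour or is a Q_n of the opposite colour.
module Submission where

open import Defs
open import Data.Nat using (ℕ; zero; suc; _+_; _*_; _∸_; _≤_; _<_; _≤′_; ≤′-refl; ≤′-step; z≤n; s≤s; s≤s⁻¹; _<?_; _≤?_)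
open import Data.Nat.Properties using (≤-refl; ≤-trans; ≤-antisym; ≤⇒≤′; ≮⇒≥; <⇒≤; +-comm)
open import Data.Fin using (Fin; toℕ)
open import Data.Fin.Properties using (toℕ<n)
open import Data.Fin.Subset using (Subset; _⊆_; ⊥; ⊤; inside; outside)
open import Data.Fin.Subset.Properties
  using (⊆-refl; ⊆-trans; ⊆-antisym; ⊆-min; ⊆-max; out⊆; s⊆s; drop-∷-⊆; _⊆?_; anySubset?)
open import Data.Vec.Base using ([]; _∷_; _++_; here)
open import Data.Product using (∃; _×_; _,_; proj₁; proj₂)
open import Data.Sum using (_⊎_; inj₁; inj₂)
open import Function.Base using (_∘_)
open import Function.Bundles using (_⇔_; mk⇔; Equivalence)
open import Function.Properties.Equivalence using () renaming (trans to ⇔-trans)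
open import Relation.Binary.Definitions using (DecidableEquality)
open import Relation.Nullary using (Dec; does; yes; no; contradiction)
open import Data.Bool.Base using (if_then_else_)
open import Relation.Nullary.Decidable using (_×-dec_)
open import Relation.Binary.PropositionalEquality using (_≡_; _≢_; refl; sym; cong; subst; module ≡-Reasoning)

open Equivalence using (to; from)

_≟_ : DecidableEquality Color
blue ≟ blue = yes refl
blue ≟ red  = no λ ()
red  ≟ blue = no λ ()
red  ≟ red  = yes refl

≢⇒≡flipColor : ∀ {a b} → a ≢ b → a ≡ flipColor b
≢⇒≡flipColor {blue} {blue} a≢b = contradiction refl a≢b
≢⇒≡flipColor {blue} {red}  _   = refl
≢⇒≡flipColor {red}  {blue} _   = refl
≢⇒≡flipColor {red}  {red}  a≢b = contradiction refl a≢b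

flipColor-≢ : ∀ a → flipColor a ≢ a
flipColor-≢ blue ()
flipColor-≢ red  ()

++⁺ : ∀ {m n} {A B : Subset m} {R S : Subset n} → A ⊆ B → R ⊆ S → A ++ R ⊆ B ++ S
++⁺ {A = []}          {B = []}          _   R⊆S = R⊆S
++⁺ {A = outside ∷ A} {B = _ ∷ B}       A⊆B R⊆S = out⊆ (++⁺ (drop-∷-⊆ A⊆B) R⊆S)
++⁺ {A = inside ∷ A}  {B = inside ∷ B}  A⊆B R⊆S = s⊆s (++⁺ (drop-∷-⊆ A⊆B) R⊆S)
++⁺ {A = inside ∷ A}  {B = outside ∷ B} A⊆B _   with A⊆B here
... | ()

++⁻ : ∀ {m n} {A B : Subset m} {R S : Subset n} → A ++ R ⊆ B ++ S → A ⊆ B × R ⊆ S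
++⁻ {A = []} {B = []} R⊆S = (λ ()) , R⊆S
++⁻ {A = _ ∷ A} {B = _ ∷ B} AR⊆BS with ++⁻ {A = A} {B = B} (drop-∷-⊆ AR⊆BS)
++⁻ {A = outside ∷ A} {B = _ ∷ B}       _     | A⊆B , R⊆S = out⊆ A⊆B , R⊆S
++⁻ {A = inside ∷ A}  {B = inside ∷ B}  _     | A⊆B , R⊆S = s⊆s A⊆B , R⊆S
++⁻ {A = inside ∷ A}  {B = outside ∷ B} AR⊆BS | _         with AR⊆BS here
... | ()

IsEmbedding : ∀ {m N} → (Subset m → Subset N) → Set
IsEmbedding e = ∀ A B → A ⊆ B ⇔ e A ⊆ e B

IsEmbedding₂ : ∀ {m m′ N} → (Subset m → Subset m′ → Subset N) → Set
IsEmbedding₂ h = ∀ A A′ B B′ → (A ⊆ A′ × B ⊆ B′) ⇔ h A B ⊆ h A′ B′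

module _ {m m′ N : ℕ} {h : Subset m → Subset m′ → Subset N} (h-emb : IsEmbedding₂ h) where

  isEmbedding₂⇒isEmbeddingˡ : ∀ B → IsEmbedding (λ A → h A B)
  isEmbedding₂⇒isEmbeddingˡ B A A′ = mk⇔ monotone reflects
    where
    monotone : A ⊆ A′ → h A B ⊆ h A′ B
    monotone A⊆A′ = to (h-emb A A′ B B) (A⊆A′ , ⊆-refl)
    reflects : h A B ⊆ h A′ B → A ⊆ A′
    reflects = proj₁ ∘ from (h-emb A A′ B B)

  isEmbedding₂⇒isEmbeddingʳ : ∀ A → IsEmbedding (h A)
  isEmbedding₂⇒isEmbeddingʳ A B B′ = mk⇔ monotone reflects
    where
    monotone : B ⊆ B′ → h A B ⊆ h A B′
    monotone B⊆B′ = to (h-emb A A B B′) (⊆-refl , B⊆B′)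
    reflects : h A B ⊆ h A B′ → B ⊆ B′
    reflects = proj₂ ∘ from (h-emb A A B B′)

  isEmbedding₂-∘ʳ : ∀ {k} {e : Subset k → Subset m′} → IsEmbedding e → IsEmbedding₂ (λ A B → h A (e B))
  isEmbedding₂-∘ʳ {e = e} e-emb A A′ B B′ = mk⇔ monotone reflects
    where
    monotone : A ⊆ A′ × B ⊆ B′ → h A (e B) ⊆ h A′ (e B′)
    monotone (A⊆A′ , B⊆B′) = to (h-emb A A′ (e B) (e B′)) (A⊆A′ , to (e-emb B B′) B⊆B′)
    reflects : h A (e B) ⊆ h A′ (e B′) → A ⊆ A′ × B ⊆ B′
    reflects hAeB⊆hA′eB′ with from (h-emb A A′ (e B) (e B′)) hAeB⊆hA′eB′
    ... | A⊆A′ , eB⊆eB′ = A⊆A′ , from (e-emb B B′) eB⊆eB′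

  graph-isEmbedding : {g : Subset m → Subset m′} → (∀ {A B} → A ⊆ B → g A ⊆ g B) →
                      IsEmbedding (λ A → h A (g A))
  graph-isEmbedding {g} g-mono A B = mk⇔ monotone reflects
    where
    monotone : A ⊆ B → h A (g A) ⊆ h B (g B)
    monotone A⊆B = to (h-emb A B (g A) (g B)) (A⊆B , g-mono A⊆B)
    reflects : h A (g A) ⊆ h B (g B) → A ⊆ B
    reflects = proj₁ ∘ from (h-emb A B (g A) (g B))

isEmbedding-∘ : ∀ {k m N} {f : Subset m → Subset N} {g : Subset k → Subset m} →
                IsEmbedding f → IsEmbedding g → IsEmbedding (f ∘ g)
isEmbedding-∘ {g = g} f-emb g-emb A B = ⇔-trans (g-emb A B) (f-emb (g A) (g B))

++-isEmbedding₂ : ∀ {m n} → IsEmbedding₂ (_++_ {m = m} {n = n})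
++-isEmbedding₂ A A′ B B′ = mk⇔ (λ (A⊆A′ , B⊆B′) → ++⁺ A⊆A′ B⊆B′) ++⁻

module _ {N : ℕ} (f : ℕ → Subset N) (f-step : ∀ i → f i ⊆ f (suc i)) where

  step⇒⊆-mono : ∀ {i j} → i ≤ j → f i ⊆ f j
  step⇒⊆-mono = go ∘ ≤⇒≤′
    where
    go : ∀ {i j} → i ≤′ j → f i ⊆ f j
    go ≤′-refl       = ⊆-refl
    go (≤′-step i≤j) = ⊆-trans (go i≤j) (f-step _)

  -- If f i ⊆ f j with j < i, then f j = f (suc j) by antisymmetry.
  step⇒⊆-reflects-≤ : ∀ {t} → (∀ j → suc j < t → f j ≢ f (suc j)) →
                      ∀ {i j} → i < t → f i ⊆ f j → i ≤ j
  step⇒⊆-reflects-≤ distinct {i} {j} i<t fi⊆fj with suc j ≤? i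
  ... | no  j≮i = ≮⇒≥ j≮i
  ... | yes j<i = contradiction
    (⊆-antisym (f-step j) (⊆-trans (step⇒⊆-mono j<i) fi⊆fj))
    (distinct j (≤-trans (s≤s j<i) i<t))

-- k vertices, coloured altColor 0, …, altColor (k-1) from the bottom, all below x.
data AltChainBelow {N : ℕ} (c : Coloring N) : ℕ → Subset N → Set where
  []   : ∀ {x} → AltChainBelow c 0 x
  snoc : ∀ {k x y} → AltChainBelow c k y → c y ≡ altColor k → y ⊆ x → AltChainBelow c (suc k) x

module _ {N : ℕ} {c : Coloring N} where

  weaken : ∀ {k x x′} → AltChainBelow c k x → x ⊆ x′ → AltChainBelow c k x′
  weaken []                 _    = []
  weaken (snoc ch cy y⊆x) x⊆x′ = snoc ch cy (⊆-trans y⊆x x⊆x′)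

  -- Indices from k on are junk and point at the top vertex (or at x for the empty chain).
  vertex : ∀ {k x} → AltChainBelow c k x → ℕ → Subset N
  vertex {x = x} [] _ = x
  vertex (snoc {k} {y = y} ch _ _) i with i <? k
  ... | yes _ = vertex ch i
  ... | no  _ = y

  vertex-⊆ : ∀ {k x} (ch : AltChainBelow c k x) i → vertex ch i ⊆ x
  vertex-⊆ []                  _ = ⊆-refl
  vertex-⊆ (snoc {k} ch _ y⊆x) i with i <? k
  ... | yes _ = ⊆-trans (vertex-⊆ ch i) y⊆x
  ... | no  _ = y⊆x

  vertex-step : ∀ {k x} (ch : AltChainBelow c k x) i → vertex ch i ⊆ vertex ch (suc i)
  vertex-step []                _ = ⊆-refl
  vertex-step (snoc {k} ch _ _) i with i <? k | suc i <? k
  ... | yes _   | yes _ = vertex-step ch i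
  ... | yes _   | no  _ = vertex-⊆ ch i
  ... | no  i≮k | yes 1+i<k = contradiction (<⇒≤ 1+i<k) i≮k
  ... | no  _   | no  _ = ⊆-refl

  vertex-color : ∀ {k x} (ch : AltChainBelow c k x) {i} → i < k → c (vertex ch i) ≡ altColor i
  vertex-color (snoc {k} ch cy _) {i} i<1+k with i <? k
  ... | yes i<k = vertex-color ch i<k
  ... | no  i≮k rewrite ≤-antisym (s≤s⁻¹ i<1+k) (≮⇒≥ i≮k) = cy

  altChainBelow⇒hasAltChain : ∀ {t x} → AltChainBelow c t x → HasAltChain t N c
  altChainBelow⇒hasAltChain {t} ch = f , induced , λ i → vertex-color ch (toℕ<n i)
    where
    f : Fin t → Subset N
    f = vertex ch ∘ toℕ
    distinct : ∀ j → suc j < t → vertex ch j ≢ vertex ch (suc j)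
    distinct j 1+j<t vj≡v1+j = flipColor-≢ (altColor j) (begin
      altColor (suc j)        ≡⟨ sym (vertex-color ch 1+j<t) ⟩
      c (vertex ch (suc j))   ≡⟨ cong c (sym vj≡v1+j) ⟩
      c (vertex ch j)         ≡⟨ vertex-color ch (<⇒≤ 1+j<t) ⟩
      altColor j              ∎)
      where open ≡-Reasoning
    induced : ∀ i j → toℕ i ≤ toℕ j ⇔ f i ⊆ f j
    induced i j = mk⇔ (step⇒⊆-mono (vertex ch) (vertex-step ch))
                      (step⇒⊆-reflects-≤ (vertex ch) (vertex-step ch) distinct (toℕ<n i))

HasSomeMonoCube : (n N : ℕ) → Coloring N → Set
HasSomeMonoCube n N c = HasMonoCube blue n N c ⊎ HasMonoCube red n N c

module _ {n N : ℕ} {c : Coloring N} where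

  hasMonoCube⇒hasSomeMonoCube : ∀ col → HasMonoCube col n N c → HasSomeMonoCube n N c
  hasMonoCube⇒hasSomeMonoCube blue = inj₁
  hasMonoCube⇒hasSomeMonoCube red  = inj₂

  extend-or-monoCube : ∀ {k x} {e : Subset n → Subset N} → IsEmbedding e →
                       AltChainBelow c k x → x ⊆ e ⊥ →
                       HasMonoCube (altColor (suc k)) n N c ⊎ AltChainBelow c (suc k) (e ⊤)
  extend-or-monoCube {k} {e = e} e-emb ch x⊆e⊥ with anySubset? (λ A → c (e A) ≟ altColor k)
  ... | yes (A , cA) = inj₂ (snoc (weaken ch (⊆-trans x⊆e⊥ (to (e-emb ⊥ A) (⊆-min A)))) cA
                                  (to (e-emb A ⊤) (⊆-max A)))
  ... | no  ∄A       = inj₁ (e , e-emb , λ A → ≢⇒≡flipColor (λ cA → ∄A (A , cA)))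

  extendBy-or-monoCube : ∀ s {k x} {h : Subset (s * n) → Subset N} → IsEmbedding h →
                         AltChainBelow c k x → x ⊆ h ⊥ →
                         HasSomeMonoCube n N c ⊎ AltChainBelow c (s + k) (h ⊤)
  extendBy-or-monoCube zero    _     ch x⊆h⊥ = inj₂ (weaken ch x⊆h⊥)
  extendBy-or-monoCube (suc s) {h = h} h-emb ch x⊆h⊥
    with extendBy-or-monoCube s (isEmbedding-∘ h-emb (isEmbedding₂⇒isEmbeddingʳ ++-isEmbedding₂ ⊥))
           ch (⊆-trans x⊆h⊥ (to (h-emb ⊥ (⊥ {n} ++ ⊥)) (⊆-min _)))
  ... | inj₁ cube = inj₁ cube
  ... | inj₂ ch′
    with extend-or-monoCube (isEmbedding-∘ h-emb (isEmbedding₂⇒isEmbeddingˡ ++-isEmbedding₂ ⊤)) ch′ ⊆-refl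
  ...   | inj₁ cube = inj₁ (hasMonoCube⇒hasSomeMonoCube _ cube)
  ...   | inj₂ ch″  = inj₂ (weaken ch″ (to (h-emb (⊤ {n} ++ ⊤) ⊤) (⊆-max _)))

  module _ {h : Subset n → Subset n → Subset N} (h-emb : IsEmbedding₂ h) where

    RedBelow : Subset n → Set
    RedBelow A = ∃ λ A′ → A′ ⊆ A × c (h A′ ⊥) ≡ red

    redBelow? : ∀ A → Dec (RedBelow A)
    redBelow? A = anySubset? (λ A′ → (A′ ⊆? A) ×-dec (c (h A′ ⊥) ≟ red))

    redBelow-mono : ∀ {A B} → A ⊆ B → RedBelow A → RedBelow B
    redBelow-mono A⊆B (A′ , A′⊆A , cA′⊥) = A′ , ⊆-trans A′⊆A A⊆B , cA′⊥

    liftRed : Subset n → Subset n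
    liftRed A = if does (redBelow? A) then ⊤ else ⊥

    liftRed-mono : ∀ {A B} → A ⊆ B → liftRed A ⊆ liftRed B
    liftRed-mono {A} {B} A⊆B with redBelow? A | redBelow? B
    ... | yes _    | yes _     = ⊆-refl
    ... | yes redA | no  ¬redB = contradiction (redBelow-mono A⊆B redA) ¬redB
    ... | no  _    | _         = ⊆-min _

    redBlueRed-or-monoCube : HasSomeMonoCube n N c ⊎ AltChainBelow c 3 (h ⊤ ⊤)
    redBlueRed-or-monoCube with anySubset? (λ A → redBelow? A ×-dec (c (h A ⊤) ≟ red))
    ... | yes (A , (A′ , A′⊆A , cA′⊥) , cA⊤) with anySubset? (λ B → c (h A B) ≟ blue)
    ...   | yes (B , cAB) = inj₂ (snoc (snoc (snoc [] cA′⊥ A′⊥⊆AB) cAB AB⊆A⊤) cA⊤ A⊤⊆⊤⊤)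
      where
      A′⊥⊆AB : h A′ ⊥ ⊆ h A B
      A′⊥⊆AB = to (h-emb A′ A ⊥ B) (A′⊆A , ⊆-min B)
      AB⊆A⊤ : h A B ⊆ h A ⊤
      AB⊆A⊤ = to (h-emb A A B ⊤) (⊆-refl , ⊆-max B)
      A⊤⊆⊤⊤ : h A ⊤ ⊆ h ⊤ ⊤
      A⊤⊆⊤⊤ = to (h-emb A ⊤ ⊤ ⊤) (⊆-max A , ⊆-refl)
    ...   | no  ∄B = inj₁ (inj₂ (h A , isEmbedding₂⇒isEmbeddingʳ h-emb A ,
                                 λ B → ≢⇒≡flipColor (λ cAB → ∄B (B , cAB))))
    redBlueRed-or-monoCube | no ∄A =
      inj₁ (inj₁ (_ , graph-isEmbedding h-emb {g = liftRed} liftRed-mono , liftRed-blue))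
      where
      liftRed-blue : ∀ A → c (h A (liftRed A)) ≡ blue
      liftRed-blue A with redBelow? A
      ... | yes redA = ≢⇒≡flipColor (λ cA⊤ → ∄A (A , redA , cA⊤))
      ... | no ¬redA = ≢⇒≡flipColor (λ cA⊥ → ¬redA (A , ⊆-refl , cA⊥))

lemma7 : (n t : ℕ) → 3 ≤ t → RtildeAltChain≤ t n ((t ∸ 1) * n)
lemma7 n (suc (suc (suc s))) (s≤s (s≤s (s≤s z≤n))) = n + (n + s * n) , ≤-refl , ramsey
  where
  pair : Subset n → Subset n → Subset (n + (n + s * n))
  pair A B = A ++ (B ++ ⊥)
  pair-emb : IsEmbedding₂ pair
  pair-emb = isEmbedding₂-∘ʳ ++-isEmbedding₂ (isEmbedding₂⇒isEmbeddingˡ ++-isEmbedding₂ ⊥)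
  rest : Subset (s * n) → Subset (n + (n + s * n))
  rest R = ⊤ {n} ++ (⊤ {n} ++ R)
  rest-emb : IsEmbedding rest
  rest-emb = isEmbedding-∘ (isEmbedding₂⇒isEmbeddingʳ ++-isEmbedding₂ (⊤ {n}))
                           (isEmbedding₂⇒isEmbeddingʳ ++-isEmbedding₂ (⊤ {n}))
  ramsey : RamseyProp (3 + s) n (n + (n + s * n))
  ramsey c with redBlueRed-or-monoCube pair-emb
  ... | inj₁ cube = inj₂ cube
  ... | inj₂ ch with extendBy-or-monoCube s rest-emb ch ⊆-refl
  ...   | inj₁ cube = inj₂ cube
  ...   | inj₂ ch′  = inj₁ (altChainBelow⇒hasAltChain
                               (subst (λ k → AltChainBelow c k (rest ⊤)) (+-comm s 3) ch′))
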